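{- Let $G_0$ be a connected graph with at least three vertices and let $u$ and $v$ be two distinct vertices of $G_0$. For integers $s,t\ge 0$, let $G_{s,t}$ be the graph obtained from $G_0$ by attaching $s$ new pendant vertices to $u$ and $t$ new pendant vertices to $v$. If $s,t\ge 1$, then $D'(G_{s,t})>\min\{D'(G_{s+t,0}),D'(G_{0,s+t})\}$.
   Context: All graphs are finite and simple. For a connected graph $G$, $d_G(x,y)$ denotes the distance between $x$ and $y$, $D_G(x)=\sum_{y\in V(G)}d_G(x,y)$, and $d_G(x)$ is the degree of $x$. The degree distance of $G$ is $D'(G)=\sum_{x\in V(G)}d_G(x)D_G(x)$. Attaching $h$ pendant vertices to a vertex $w$ means adding $h$ new vertices, each joined only to $w$. -}

module Defs where

open import Data.Nat using (ℕ; zero; suc; _+_; _*_)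
open import Data.Bool using (Bool; true; false; _∧_; _∨_; if_then_else_)
open import Data.Fin using (Fin; splitAt)
open import Data.Fin.Properties using (_≟_)
open import Data.Sum using (_⊎_; inj₁; inj₂)
open import Data.Product using (∃; _×_)
open import Relation.Nullary.Decidable using (⌊_⌋)
open import Relation.Binary.PropositionalEquality using (_≡_)

record Graph : Set where
  field
    n   : ℕ
    adj : Fin n → Fin n → Bool
open Graph public

IsSimple : Graph → Set
IsSimple G = (∀ x y → adj G x y ≡ adj G y x) × (∀ x → adj G x x ≡ false)

sumFin : ∀ {m} → (Fin m → ℕ) → ℕ
sumFin {zero}  f = 0
sumFin {suc m} f = f Fin.zero + sumFin (λ i → f (Fin.suc i))

anyFin : ∀ {m} → (Fin m → Bool) → Bool
anyFin {zero}  f = false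
anyFin {suc m} f = f Fin.zero ∨ anyFin (λ i → f (Fin.suc i))

reach : (G : Graph) → ℕ → Fin (n G) → Fin (n G) → Bool
reach G zero    x y = ⌊ x ≟ y ⌋
reach G (suc k) x y = reach G k x y ∨ anyFin (λ z → reach G k x z ∧ adj G z y)

Connected : Graph → Set
Connected G = ∀ x y → ∃ λ k → reach G k x y ≡ true

-- bounded minimisation: least k ≤ b with p k ≡ true (b if none)
μ : ℕ → (ℕ → Bool) → ℕ
μ zero    p = 0
μ (suc b) p = if p 0 then 0 else suc (μ b (λ k → p (suc k)))

-- distance d_G(x,y): least k with a walk of length ≤ k from x to y
-- (in a connected graph on n vertices this is < n, so the bound n is never hit)
dist : (G : Graph) → Fin (n G) → Fin (n G) → ℕ
dist G x y = μ (n G) (λ k → reach G k x y)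

transmission : (G : Graph) → Fin (n G) → ℕ
transmission G x = sumFin (λ y → dist G x y)

degree : (G : Graph) → Fin (n G) → ℕ
degree G x = sumFin (λ y → if adj G x y then 1 else 0)

degreeDistance : Graph → ℕ
degreeDistance G = sumFin (λ x → degree G x * transmission G x)

-- Vertices of G_{s,t}: Fin (n + (s + t)); the first n are the vertices of G,
-- the next s are pendants at u, the last t are pendants at v.
data Kind (m s t : ℕ) : Set where
  old  : Fin m → Kind m s t
  pend : Fin m → Kind m s t   -- pendant vertex, attached to the given vertex

kind : ∀ {m} s t → Fin m → Fin m → Fin (m + (s + t)) → Kind m s t
kind {m} s t u v i with splitAt m i
... | inj₁ a = old a
... | inj₂ b with splitAt s b
...   | inj₁ _ = pend u
...   | inj₂ _ = pend v

kindAdj : ∀ {m s t} → (Fin m → Fin m → Bool) → Kind m s t → Kind m s t → Bool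
kindAdj A (old a)  (old b)  = A a b
kindAdj A (old a)  (pend w) = ⌊ a ≟ w ⌋
kindAdj A (pend w) (old b)  = ⌊ w ≟ b ⌋
kindAdj A (pend _) (pend _) = false

attach : (G : Graph) → Fin (n G) → Fin (n G) → ℕ → ℕ → Graph
attach G u v s t = record
  { n   = n G + (s + t)
  ; adj = λ i j → kindAdj (adj G) (kind s t u v i) (kind s t u v j)
  }

-- Write H = G_{s,t}. Walks in H are walks in G extended by at most one pendant edge at each end, so
-- a pendant at w is at distance d(x,w) + 1 from an old vertex x and d(w,w') + 2 from a pendant at
-- w' ≠ w (2 if w' = w). Summing degree × transmission over old and pendant vertices gives
--   D'(G_{s,t}) + 2(s + t) = C + sX + tY + 3(s² + t²) + stK
-- with C, X, Y, K depending only on G, u, v, and K = 4 d(u,v) + 6 ≥ 10. Then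
-- D'(G_{s,t}) − D'(G_{s+t,0}) = t(Y − X) + st(K − 6), and symmetrically for G_{0,s+t}, so moving
-- all pendants to whichever of u, v has the smaller weight strictly decreases D'.

module Submission where

open import Defs
open import Data.Bool using (Bool; true; false; _∧_; _∨_; if_then_else_)
open import Data.Bool.Properties using (∨-assoc; ∨-identityʳ; ∧-zeroʳ; ∧-identityʳ)
open import Data.Fin using (Fin; _↑ˡ_; _↑ʳ_; splitAt) renaming (zero to fzero; suc to fsuc)
open import Data.Fin.Properties using (_≟_; splitAt-↑ˡ; splitAt-↑ʳ; ↑ˡ-injective; ↑ʳ-injective; suc-injective)
open import Data.Nat using (ℕ; zero; suc; _+_; _*_; _≤_; _<_; _>_; _⊓_; s≤s; z≤n)
open import Data.Nat.Properties
  using (+-assoc; +-comm; +-identityʳ; *-zeroʳ; *-identityˡ; *-distribˡ-+; *-distribʳ-+; ≤-trans; ≤-total;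
         m≤m+n; m<m+n; +-mono-≤; +-cancelʳ-<; m≤n⇒∃[o]m+o≡n; +-distribʳ-⊓; m<n⇒m⊓o<n; m<n⇒o⊓m<n)
open import Data.Nat.Tactic.RingSolver using (solve-∀)
open import Data.Product using (Σ; _×_; _,_)
open import Data.Sum using (_⊎_; inj₁; inj₂)
open import Relation.Nullary using (yes; no; contradiction)
open import Relation.Nullary.Decidable using (⌊_⌋)
open import Relation.Binary.PropositionalEquality
open ≡-Reasoning

≟-≡ : ∀ {m} {x y : Fin m} → x ≡ y → ⌊ x ≟ y ⌋ ≡ true
≟-≡ {x = x} {y} x≡y with x ≟ y
... | yes _ = refl
... | no x≢y = contradiction x≡y x≢y

≟-≢ : ∀ {m} {x y : Fin m} → x ≢ y → ⌊ x ≟ y ⌋ ≡ false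
≟-≢ {x = x} {y} x≢y with x ≟ y
... | yes x≡y = contradiction x≡y x≢y
... | no _ = refl

≟-true : ∀ {m} {x y : Fin m} → ⌊ x ≟ y ⌋ ≡ true → x ≡ y
≟-true {x = x} {y} eq with x ≟ y
... | yes x≡y = x≡y

≟-injective : ∀ {m r} (f : Fin m → Fin r) → (∀ x y → f x ≡ f y → x ≡ y) →
  ∀ x y → ⌊ f x ≟ f y ⌋ ≡ ⌊ x ≟ y ⌋
≟-injective f f-inj x y with x ≟ y
... | yes x≡y = ≟-≡ (cong f x≡y)
... | no  x≢y = ≟-≢ (λ fx≡fy → x≢y (f-inj x y fx≡fy))

↑ˡ≢↑ʳ : ∀ {m r} (i : Fin m) (j : Fin r) → i ↑ˡ r ≢ m ↑ʳ j
↑ˡ≢↑ʳ {m} {r} i j eq with trans (sym (splitAt-↑ˡ m i r)) (trans (cong (splitAt m) eq) (splitAt-↑ʳ m r j))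
... | ()

∧-true : ∀ {x y} → x ∧ y ≡ true → x ≡ true × y ≡ true
∧-true {true} {true} refl = refl , refl

∨-true : ∀ {x y} → x ∨ y ≡ true → x ≡ true ⊎ y ≡ true
∨-true {true} refl = inj₁ refl
∨-true {false} y≡true = inj₂ y≡true

∨-introˡ : ∀ {x} y → x ≡ true → x ∨ y ≡ true
∨-introˡ y refl = refl

∨-absorbʳ : ∀ x y z → (z ≡ true → x ∨ y ≡ true) → x ∨ (y ∨ z) ≡ x ∨ y
∨-absorbʳ true  y     z     z⇒x∨y = refl
∨-absorbʳ false true  z     z⇒x∨y = refl
∨-absorbʳ false false false z⇒x∨y = refl
∨-absorbʳ false false true  z⇒x∨y = contradiction (z⇒x∨y refl) λ ()

∨-subsume : ∀ e x y → (x ≡ true → y ≡ true) → (e ∨ x) ∨ (y ∨ false) ≡ e ∨ y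
∨-subsume true  x     y     x⇒y = refl
∨-subsume false false false x⇒y = refl
∨-subsume false false true  x⇒y = refl
∨-subsume false true  true  x⇒y = refl
∨-subsume false true  false x⇒y = contradiction (x⇒y refl) λ ()

anyFin-cong : ∀ {m} {f g : Fin m → Bool} → (∀ i → f i ≡ g i) → anyFin f ≡ anyFin g
anyFin-cong {zero}  f≗g = refl
anyFin-cong {suc m} f≗g = cong₂ _∨_ (f≗g fzero) (anyFin-cong (λ i → f≗g (fsuc i)))

anyFin-++ : ∀ m r (f : Fin (m + r) → Bool) →
  anyFin f ≡ anyFin (λ i → f (i ↑ˡ r)) ∨ anyFin (λ j → f (m ↑ʳ j))
anyFin-++ zero    r f = refl
anyFin-++ (suc m) r f = trans (cong (f fzero ∨_) (anyFin-++ m r (λ i → f (fsuc i))))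
                              (sym (∨-assoc (f fzero) _ _))

anyFin-false : ∀ {m} {f : Fin m → Bool} → (∀ i → f i ≡ false) → anyFin f ≡ false
anyFin-false {zero}  f≗false = refl
anyFin-false {suc m} f≗false rewrite f≗false fzero = anyFin-false (λ i → f≗false (fsuc i))

anyFin-true : ∀ {m} (f : Fin m → Bool) → anyFin f ≡ true → Σ (Fin m) (λ i → f i ≡ true)
anyFin-true {suc m} f any≡true with f fzero in eq
... | true  = fzero , eq
... | false with anyFin-true (λ i → f (fsuc i)) any≡true
...   | i , fi≡true = fsuc i , fi≡true

anyFin-single : ∀ {m} (f : Fin m → Bool) p → (∀ i → i ≢ p → f i ≡ false) → anyFin f ≡ f p
anyFin-single {suc m} f fzero     rest =
  trans (cong (f fzero ∨_) (anyFin-false (λ i → rest (fsuc i) λ ()))) (∨-identityʳ _)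
anyFin-single {suc m} f (fsuc p) rest rewrite rest fzero (λ ()) =
  anyFin-single (λ i → f (fsuc i)) p (λ i i≢p → rest (fsuc i) (λ eq → i≢p (suc-injective eq)))

anyFin-∧-≟ : ∀ {m} (f : Fin m → Bool) w → anyFin (λ c → f c ∧ ⌊ c ≟ w ⌋) ≡ f w
anyFin-∧-≟ f w = trans (anyFin-single _ w (λ c c≢w → trans (cong (f c ∧_) (≟-≢ c≢w)) (∧-zeroʳ (f c))))
                       (trans (cong (f w ∧_) (≟-≡ refl)) (∧-identityʳ (f w)))

anyFin-≟-∧ : ∀ {m} (f : Fin m → Bool) w → anyFin (λ c → ⌊ w ≟ c ⌋ ∧ f c) ≡ f w
anyFin-≟-∧ f w = trans (anyFin-single _ w (λ c c≢w → cong (_∧ f c) (≟-≢ (≢-sym c≢w))))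
                       (cong (_∧ f w) (≟-≡ refl))

sumFin-cong : ∀ {m} {f g : Fin m → ℕ} → (∀ i → f i ≡ g i) → sumFin f ≡ sumFin g
sumFin-cong {zero}  f≗g = refl
sumFin-cong {suc m} f≗g = cong₂ _+_ (f≗g fzero) (sumFin-cong (λ i → f≗g (fsuc i)))

sumFin-++ : ∀ m r (f : Fin (m + r) → ℕ) →
  sumFin f ≡ sumFin (λ i → f (i ↑ˡ r)) + sumFin (λ j → f (m ↑ʳ j))
sumFin-++ zero    r f = refl
sumFin-++ (suc m) r f = trans (cong (f fzero +_) (sumFin-++ m r (λ i → f (fsuc i))))
                              (sym (+-assoc (f fzero) _ _))

sumFin-zero : ∀ {m} {f : Fin m → ℕ} → (∀ i → f i ≡ 0) → sumFin f ≡ 0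
sumFin-zero {zero}  f≗0 = refl
sumFin-zero {suc m} f≗0 rewrite f≗0 fzero = sumFin-zero (λ i → f≗0 (fsuc i))

sumFin-const : ∀ m c → sumFin {m} (λ _ → c) ≡ m * c
sumFin-const zero    c = refl
sumFin-const (suc m) c = cong (c +_) (sumFin-const m c)

sumFin-+ : ∀ {m} (f g : Fin m → ℕ) → sumFin (λ i → f i + g i) ≡ sumFin f + sumFin g
sumFin-+ {zero}  f g = refl
sumFin-+ {suc m} f g rewrite sumFin-+ (λ i → f (fsuc i)) (λ i → g (fsuc i)) =
  interchange (f fzero) (g fzero) _ _
  where
  interchange : ∀ a b c d → a + b + (c + d) ≡ a + c + (b + d)
  interchange = solve-∀

sumFin-*ˡ : ∀ {m} c (f : Fin m → ℕ) → sumFin (λ i → c * f i) ≡ c * sumFin f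
sumFin-*ˡ {zero}  c f = sym (*-zeroʳ c)
sumFin-*ˡ {suc m} c f rewrite sumFin-*ˡ c (λ i → f (fsuc i)) = sym (*-distribˡ-+ c (f fzero) _)

sumFin-single : ∀ {m} (f : Fin m → ℕ) p → (∀ i → i ≢ p → f i ≡ 0) → sumFin f ≡ f p
sumFin-single {suc m} f fzero     rest =
  trans (cong (f fzero +_) (sumFin-zero (λ i → rest (fsuc i) λ ()))) (+-identityʳ _)
sumFin-single {suc m} f (fsuc p) rest rewrite rest fzero (λ ()) =
  sumFin-single (λ i → f (fsuc i)) p (λ i i≢p → rest (fsuc i) (λ eq → i≢p (suc-injective eq)))

sumFin-except : ∀ {m} (f g : Fin m → ℕ) p → f p ≡ 0 → (∀ i → i ≢ p → f i ≡ g i) →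
  sumFin f + g p ≡ sumFin g
sumFin-except {suc m} f g fzero     fp≡0 rest rewrite fp≡0 =
  trans (cong (_+ g fzero) (sumFin-cong (λ i → rest (fsuc i) λ ()))) (+-comm _ (g fzero))
sumFin-except {suc m} f g (fsuc p) fp≡0 rest rewrite rest fzero (λ ()) =
  trans (+-assoc (g fzero) _ _) (cong (g fzero +_)
    (sumFin-except (λ i → f (fsuc i)) (λ i → g (fsuc i)) p fp≡0
      (λ i i≢p → rest (fsuc i) (λ eq → i≢p (suc-injective eq)))))

sumFin-linear : ∀ {m} (x y z : Fin m → ℕ) s t →
  sumFin (λ a → x a + (s * y a + t * z a)) ≡ sumFin x + (s * sumFin y + t * sumFin z)
sumFin-linear x y z s t = begin
  sumFin (λ a → x a + (s * y a + t * z a))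
    ≡⟨ sumFin-+ x _ ⟩
  sumFin x + sumFin (λ a → s * y a + t * z a)
    ≡⟨ cong (sumFin x +_) (trans (sumFin-+ (λ a → s * y a) (λ a → t * z a))
                                    (cong₂ _+_ (sumFin-*ˡ s y) (sumFin-*ˡ t z))) ⟩
  sumFin x + (s * sumFin y + t * sumFin z) ∎

bit : Bool → ℕ
bit x = if x then 1 else 0

δ : ∀ {m} → Fin m → Fin m → ℕ
δ a w = bit ⌊ a ≟ w ⌋

sumFin-δ : ∀ {m} (g : Fin m → ℕ) w → sumFin (λ a → δ a w * g a) ≡ g w
sumFin-δ g w = trans (sumFin-single _ w (λ a a≢w → cong (λ x → bit x * g a) (≟-≢ a≢w)))
                     (trans (cong (λ x → bit x * g w) (≟-≡ {x = w} refl)) (+-identityʳ (g w)))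

sumFin-δ-row : ∀ {m} (w : Fin m) → sumFin (δ w) ≡ 1
sumFin-δ-row w = trans (sumFin-single (δ w) w (λ a a≢w → cong bit (≟-≢ (≢-sym a≢w))))
                       (cong bit (≟-≡ {x = w} refl))

μ-cong : ∀ B {p q : ℕ → Bool} → (∀ k → p k ≡ q k) → μ B p ≡ μ B q
μ-cong zero    p≗q = refl
μ-cong (suc B) {p} {q} p≗q rewrite p≗q 0 with q 0
... | true  = refl
... | false = cong suc (μ-cong B (λ k → p≗q (suc k)))

μ-zero : ∀ B (p : ℕ → Bool) → p 0 ≡ true → μ B p ≡ 0
μ-zero zero    p p0 = refl
μ-zero (suc B) p p0 rewrite p0 = refl

μ-exact : ∀ j B (p : ℕ → Bool) → j < B → (∀ k → k < j → p k ≡ false) → p j ≡ true → μ B p ≡ j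
μ-exact zero    B       p j<B below pj = μ-zero B p pj
μ-exact (suc j) (suc B) p (s≤s j<B) below pj rewrite below 0 (s≤s z≤n) =
  cong suc (μ-exact j B (λ k → p (suc k)) j<B (λ k k<j → below (suc k) (s≤s k<j)) pj)

μ-lower : ∀ j B (p : ℕ → Bool) → j ≤ B → (∀ k → k < j → p k ≡ false) → j ≤ μ B p
μ-lower zero    B       p j≤B below = z≤n
μ-lower (suc j) (suc B) p (s≤s j≤B) below rewrite below 0 (s≤s z≤n) =
  s≤s (μ-lower j B (λ k → p (suc k)) j≤B (λ k k<j → below (suc k) (s≤s k<j)))

-- reach⁺ G k a b: a walk of length ≤ k from a to a pendant vertex hanging at b;
-- reach⁺⁺ G k a b: one between pendant vertices hanging at a and at b.
reach⁺ : (G : Graph) → ℕ → Fin (n G) → Fin (n G) → Bool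
reach⁺ G zero    a b = false
reach⁺ G (suc k) a b = reach G k a b

reach⁺⁺ : (G : Graph) → ℕ → Fin (n G) → Fin (n G) → Bool
reach⁺⁺ G zero    a b = false
reach⁺⁺ G (suc k) a b = reach⁺ G k a b

module _ (G : Graph) where

  reach-mono : ∀ k {a b} → reach G k a b ≡ true → reach G (suc k) a b ≡ true
  reach-mono k = ∨-introˡ _

  reach-refl : ∀ k a → reach G k a a ≡ true
  reach-refl zero    a = ≟-≡ refl
  reach-refl (suc k) a = reach-mono k (reach-refl k a)

  reach⁺⇒reach : ∀ k {a b} → reach⁺ G k a b ≡ true → reach G k a b ≡ true
  reach⁺⇒reach (suc k) = reach-mono k

  reach⁺⁺⇒reach⁺ : ∀ k {a b} → reach⁺⁺ G k a b ≡ true → reach⁺ G k a b ≡ true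
  reach⁺⁺⇒reach⁺ (suc k) = reach⁺⇒reach k

dist-refl : ∀ G x → dist G x x ≡ 0
dist-refl G x = μ-zero (n G) _ (≟-≡ refl)

-- Distances searched up to a bound b (the order of the enlarged graph): within G, from a to a
-- pendant vertex at w, and between pendant vertices at a and at w.
dist₀ dist₁ dist₂ : (G : Graph) → ℕ → Fin (n G) → Fin (n G) → ℕ
dist₀ G b a w = μ b (λ k → reach G k a w)
dist₁ G b a w = μ b (λ k → reach⁺ G k a w)
dist₂ G b a w = μ b (λ k → reach⁺⁺ G k a w)

module _ (G : Graph) {b : ℕ} where

  dist₁-self : 2 ≤ b → ∀ w → dist₁ G b w w ≡ 1
  dist₁-self 2≤b w = μ-exact 1 b _ 2≤b (λ { zero _ → refl ; (suc _) (s≤s ()) }) (≟-≡ refl)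

  dist₂-self : 3 ≤ b → ∀ w → dist₂ G b w w ≡ 2
  dist₂-self 3≤b w =
    μ-exact 2 b _ 3≤b (λ { zero _ → refl ; (suc zero) _ → refl ; (suc (suc _)) (s≤s (s≤s ())) }) (≟-≡ refl)

  dist₁-≢ : 2 ≤ b → ∀ {a w} → a ≢ w → 2 ≤ dist₁ G b a w
  dist₁-≢ 2≤b a≢w = μ-lower 2 b _ 2≤b (λ { zero _ → refl ; (suc zero) _ → ≟-≢ a≢w ; (suc (suc _)) (s≤s (s≤s ())) })

  dist₂-≢ : 3 ≤ b → ∀ {a w} → a ≢ w → 3 ≤ dist₂ G b a w
  dist₂-≢ 3≤b a≢w = μ-lower 3 b _ 3≤b (λ { zero _ → refl ; (suc zero) _ → refl ; (suc (suc zero)) _ → ≟-≢ a≢w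
                                     ; (suc (suc (suc _))) (s≤s (s≤s (s≤s ()))) })

module Attached (G : Graph) (u v : Fin (n G)) (s t : ℕ) where

  H : Graph
  H = attach G u v s t

  base : Fin (n G) → Fin (n H)
  base a = a ↑ˡ (s + t)

  pendant : Fin (s + t) → Fin (n H)
  pendant p = n G ↑ʳ p

  anchor : Fin (s + t) → Fin (n G)
  anchor p with splitAt s p
  ... | inj₁ _ = u
  ... | inj₂ _ = v

  anchor-↑ˡ : ∀ i → anchor (i ↑ˡ t) ≡ u
  anchor-↑ˡ i rewrite splitAt-↑ˡ s i t = refl

  anchor-↑ʳ : ∀ j → anchor (s ↑ʳ j) ≡ v
  anchor-↑ʳ j rewrite splitAt-↑ʳ s t j = refl

  kind-base : ∀ a → kind s t u v (base a) ≡ old a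
  kind-base a rewrite splitAt-↑ˡ (n G) a (s + t) = refl

  kind-pendant : ∀ p → kind s t u v (pendant p) ≡ pend (anchor p)
  kind-pendant p rewrite splitAt-↑ʳ (n G) (s + t) p with splitAt s p
  ... | inj₁ _ = refl
  ... | inj₂ _ = refl

  adj-base-base : ∀ a b → adj H (base a) (base b) ≡ adj G a b
  adj-base-base a b = cong₂ (kindAdj (adj G)) (kind-base a) (kind-base b)

  adj-base-pendant : ∀ a q → adj H (base a) (pendant q) ≡ ⌊ a ≟ anchor q ⌋
  adj-base-pendant a q = cong₂ (kindAdj (adj G)) (kind-base a) (kind-pendant q)

  adj-pendant-base : ∀ p b → adj H (pendant p) (base b) ≡ ⌊ anchor p ≟ b ⌋
  adj-pendant-base p b = cong₂ (kindAdj (adj G)) (kind-pendant p) (kind-base b)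

  adj-pendant-pendant : ∀ p q → adj H (pendant p) (pendant q) ≡ false
  adj-pendant-pendant p q = cong₂ (kindAdj (adj G)) (kind-pendant p) (kind-pendant q)

  reach-step : ∀ k x y → reach H (suc k) x y ≡
    reach H k x y ∨ (anyFin (λ c → reach H k x (base c) ∧ adj H (base c) y)
                    ∨ anyFin (λ p → reach H k x (pendant p) ∧ adj H (pendant p) y))
  reach-step k x y = cong (reach H k x y ∨_) (anyFin-++ (n G) (s + t) _)

  base≟base : ∀ a b → ⌊ base a ≟ base b ⌋ ≡ ⌊ a ≟ b ⌋
  base≟base = ≟-injective base (↑ˡ-injective (s + t))

  pendant≟pendant : ∀ p q → ⌊ pendant p ≟ pendant q ⌋ ≡ ⌊ p ≟ q ⌋
  pendant≟pendant = ≟-injective pendant (↑ʳ-injective (n G))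

  pendant-hop : ∀ k a b → anyFin (λ p → reach⁺ G k a (anchor p) ∧ ⌊ anchor p ≟ b ⌋) ≡ true →
    reach G k a b ≡ true
  pendant-hop k a b any≡true with anyFin-true _ any≡true
  ... | p , hop with ∧-true {reach⁺ G k a (anchor p)} hop
  ...   | reached , at-b rewrite ≟-true at-b = reach⁺⇒reach G k reached

  pendant-detour : ∀ k p b →
    anyFin (λ q → (⌊ p ≟ q ⌋ ∨ reach⁺⁺ G k (anchor p) (anchor q)) ∧ ⌊ anchor q ≟ b ⌋) ≡ true →
    reach G k (anchor p) b ≡ true
  pendant-detour k p b any≡true with anyFin-true _ any≡true
  ... | q , hop with ∧-true {⌊ p ≟ q ⌋ ∨ reach⁺⁺ G k (anchor p) (anchor q)} hop
  ...   | reached , at-b with ∨-true {⌊ p ≟ q ⌋} reached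
  ...     | inj₁ p≡q = subst (λ x → reach G k (anchor p) x ≡ true)
                         (trans (cong anchor (≟-true p≡q)) (≟-true at-b)) (reach-refl G k (anchor p))
  ...     | inj₂ via = subst (λ x → reach G k (anchor p) x ≡ true)
                         (≟-true at-b) (reach⁺⇒reach G k (reach⁺⁺⇒reach⁺ G k via))

  mutual
    reach-base-base : ∀ k a b → reach H k (base a) (base b) ≡ reach G k a b
    reach-base-base zero    a b = base≟base a b
    reach-base-base (suc k) a b = begin
      reach H (suc k) (base a) (base b)
        ≡⟨ reach-step k (base a) (base b) ⟩
      reach H k (base a) (base b)
        ∨ (anyFin (λ c → reach H k (base a) (base c) ∧ adj H (base c) (base b))
          ∨ anyFin (λ p → reach H k (base a) (pendant p) ∧ adj H (pendant p) (base b)))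
        ≡⟨ cong₂ _∨_ (reach-base-base k a b) (cong₂ _∨_
             (anyFin-cong (λ c → cong₂ _∧_ (reach-base-base k a c) (adj-base-base c b)))
             (anyFin-cong (λ p → cong₂ _∧_ (reach-base-pendant k a p) (adj-pendant-base p b)))) ⟩
      reach G k a b
        ∨ (anyFin (λ c → reach G k a c ∧ adj G c b)
          ∨ anyFin (λ p → reach⁺ G k a (anchor p) ∧ ⌊ anchor p ≟ b ⌋))
        ≡⟨ ∨-absorbʳ (reach G k a b) (anyFin (λ c → reach G k a c ∧ adj G c b)) _
             (λ hop → ∨-introˡ _ (pendant-hop k a b hop)) ⟩
      reach G (suc k) a b ∎

    reach-base-pendant : ∀ k a q → reach H k (base a) (pendant q) ≡ reach⁺ G k a (anchor q)
    reach-base-pendant zero    a q = ≟-≢ (↑ˡ≢↑ʳ a q)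
    reach-base-pendant (suc k) a q = begin
      reach H (suc k) (base a) (pendant q)
        ≡⟨ reach-step k (base a) (pendant q) ⟩
      reach H k (base a) (pendant q)
        ∨ (anyFin (λ c → reach H k (base a) (base c) ∧ adj H (base c) (pendant q))
          ∨ anyFin (λ p → reach H k (base a) (pendant p) ∧ adj H (pendant p) (pendant q)))
        ≡⟨ cong₂ _∨_ (reach-base-pendant k a q) (cong₂ _∨_
             (anyFin-cong (λ c → cong₂ _∧_ (reach-base-base k a c) (adj-base-pendant c q)))
             (anyFin-false (λ p → trans (cong (_ ∧_) (adj-pendant-pendant p q)) (∧-zeroʳ _)))) ⟩
      reach⁺ G k a (anchor q) ∨ (anyFin (λ c → reach G k a c ∧ ⌊ c ≟ anchor q ⌋) ∨ false)
        ≡⟨ cong (λ z → reach⁺ G k a (anchor q) ∨ (z ∨ false)) (anyFin-∧-≟ (reach G k a) (anchor q)) ⟩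
      reach⁺ G k a (anchor q) ∨ (reach G k a (anchor q) ∨ false)
        ≡⟨ ∨-subsume false _ _ (reach⁺⇒reach G k) ⟩
      reach⁺ G (suc k) a (anchor q) ∎

    reach-pendant-base : ∀ k p b → reach H k (pendant p) (base b) ≡ reach⁺ G k (anchor p) b
    reach-pendant-base zero    p b = ≟-≢ (λ eq → ↑ˡ≢↑ʳ b p (sym eq))
    reach-pendant-base (suc k) p b = begin
      reach H (suc k) (pendant p) (base b)
        ≡⟨ reach-step k (pendant p) (base b) ⟩
      reach H k (pendant p) (base b)
        ∨ (anyFin (λ c → reach H k (pendant p) (base c) ∧ adj H (base c) (base b))
          ∨ anyFin (λ q → reach H k (pendant p) (pendant q) ∧ adj H (pendant q) (base b)))
        ≡⟨ cong₂ _∨_ (reach-pendant-base k p b) (cong₂ _∨_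
             (anyFin-cong (λ c → cong₂ _∧_ (reach-pendant-base k p c) (adj-base-base c b)))
             (anyFin-cong (λ q → cong₂ _∧_ (reach-pendant-pendant k p q) (adj-pendant-base q b)))) ⟩
      reach⁺ G k (anchor p) b
        ∨ (anyFin (λ c → reach⁺ G k (anchor p) c ∧ adj G c b)
          ∨ anyFin (λ q → (⌊ p ≟ q ⌋ ∨ reach⁺⁺ G k (anchor p) (anchor q)) ∧ ⌊ anchor q ≟ b ⌋))
        ≡⟨ leave-pendant k ⟩
      reach G k (anchor p) b ∎
      where
      leave-pendant : ∀ k →
        reach⁺ G k (anchor p) b
          ∨ (anyFin (λ c → reach⁺ G k (anchor p) c ∧ adj G c b)
            ∨ anyFin (λ q → (⌊ p ≟ q ⌋ ∨ reach⁺⁺ G k (anchor p) (anchor q)) ∧ ⌊ anchor q ≟ b ⌋))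
        ≡ reach G k (anchor p) b
      leave-pendant zero = begin
        anyFin {n G} (λ c → false) ∨ anyFin (λ q → (⌊ p ≟ q ⌋ ∨ false) ∧ ⌊ anchor q ≟ b ⌋)
          ≡⟨ cong₂ _∨_ (anyFin-false {n G} (λ _ → refl))
               (anyFin-cong (λ q → cong (_∧ ⌊ anchor q ≟ b ⌋) (∨-identityʳ ⌊ p ≟ q ⌋))) ⟩
        false ∨ anyFin (λ q → ⌊ p ≟ q ⌋ ∧ ⌊ anchor q ≟ b ⌋)
          ≡⟨ anyFin-≟-∧ (λ q → ⌊ anchor q ≟ b ⌋) p ⟩
        ⌊ anchor p ≟ b ⌋ ∎
      leave-pendant (suc k) =
        ∨-absorbʳ (reach G k (anchor p) b) (anyFin (λ c → reach G k (anchor p) c ∧ adj G c b)) _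
          (pendant-detour (suc k) p b)

    reach-pendant-pendant : ∀ k p q →
      reach H k (pendant p) (pendant q) ≡ ⌊ p ≟ q ⌋ ∨ reach⁺⁺ G k (anchor p) (anchor q)
    reach-pendant-pendant zero    p q = trans (pendant≟pendant p q) (sym (∨-identityʳ _))
    reach-pendant-pendant (suc k) p q = begin
      reach H (suc k) (pendant p) (pendant q)
        ≡⟨ reach-step k (pendant p) (pendant q) ⟩
      reach H k (pendant p) (pendant q)
        ∨ (anyFin (λ c → reach H k (pendant p) (base c) ∧ adj H (base c) (pendant q))
          ∨ anyFin (λ r → reach H k (pendant p) (pendant r) ∧ adj H (pendant r) (pendant q)))
        ≡⟨ cong₂ _∨_ (reach-pendant-pendant k p q) (cong₂ _∨_
             (anyFin-cong (λ c → cong₂ _∧_ (reach-pendant-base k p c) (adj-base-pendant c q)))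
             (anyFin-false (λ r → trans (cong (_ ∧_) (adj-pendant-pendant r q)) (∧-zeroʳ _)))) ⟩
      (⌊ p ≟ q ⌋ ∨ reach⁺⁺ G k (anchor p) (anchor q))
        ∨ (anyFin (λ c → reach⁺ G k (anchor p) c ∧ ⌊ c ≟ anchor q ⌋) ∨ false)
        ≡⟨ cong (λ z → (⌊ p ≟ q ⌋ ∨ reach⁺⁺ G k (anchor p) (anchor q)) ∨ (z ∨ false))
             (anyFin-∧-≟ (reach⁺ G k (anchor p)) (anchor q)) ⟩
      (⌊ p ≟ q ⌋ ∨ reach⁺⁺ G k (anchor p) (anchor q)) ∨ (reach⁺ G k (anchor p) (anchor q) ∨ false)
        ≡⟨ ∨-subsume ⌊ p ≟ q ⌋ _ _ (reach⁺⁺⇒reach⁺ G k) ⟩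
      ⌊ p ≟ q ⌋ ∨ reach⁺⁺ G (suc k) (anchor p) (anchor q) ∎

  dist-base-base : ∀ a b → dist H (base a) (base b) ≡ dist₀ G (n H) a b
  dist-base-base a b = μ-cong (n H) (λ k → reach-base-base k a b)

  dist-base-pendant : ∀ a q → dist H (base a) (pendant q) ≡ dist₁ G (n H) a (anchor q)
  dist-base-pendant a q = μ-cong (n H) (λ k → reach-base-pendant k a q)

  dist-pendant-base : ∀ p b → dist H (pendant p) (base b) ≡ dist₁ G (n H) (anchor p) b
  dist-pendant-base p b = μ-cong (n H) (λ k → reach-pendant-base k p b)

  dist-pendant-pendant : ∀ {p} q → q ≢ p → dist H (pendant p) (pendant q) ≡ dist₂ G (n H) (anchor p) (anchor q)
  dist-pendant-pendant {p} q q≢p =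
    μ-cong (n H) (λ k → trans (reach-pendant-pendant k p q)
                                (cong (_∨ reach⁺⁺ G k (anchor p) (anchor q)) (≟-≢ (≢-sym q≢p))))

  sum-pendants : ∀ (g : Fin (n G) → ℕ) → sumFin (λ q → g (anchor q)) ≡ s * g u + t * g v
  sum-pendants g = trans (sumFin-++ s t _) (cong₂ _+_
    (trans (sumFin-cong (λ i → cong g (anchor-↑ˡ i))) (sumFin-const s (g u)))
    (trans (sumFin-cong (λ j → cong g (anchor-↑ʳ j))) (sumFin-const t (g v))))

  degree-base : ∀ a → degree H (base a) ≡ degree G a + (s * δ a u + t * δ a v)
  degree-base a = trans (sumFin-++ (n G) (s + t) _) (cong₂ _+_
    (sumFin-cong (λ b → cong bit (adj-base-base a b)))
    (trans (sumFin-cong (λ q → cong bit (adj-base-pendant a q))) (sum-pendants (δ a))))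

  degree-pendant : ∀ p → degree H (pendant p) ≡ 1
  degree-pendant p = begin
    degree H (pendant p)
      ≡⟨ sumFin-++ (n G) (s + t) _ ⟩
    sumFin (λ b → bit (adj H (pendant p) (base b))) + sumFin (λ q → bit (adj H (pendant p) (pendant q)))
      ≡⟨ cong₂ _+_ (sumFin-cong (λ b → cong bit (adj-pendant-base p b)))
                   (sumFin-zero (λ q → cong bit (adj-pendant-pendant p q))) ⟩
    sumFin (δ (anchor p)) + 0
      ≡⟨ trans (+-identityʳ _) (sumFin-δ-row (anchor p)) ⟩
    1 ∎

  d₀ d₁ d₂ : Fin (n G) → Fin (n G) → ℕ
  d₀ = dist₀ G (n H)
  d₁ = dist₁ G (n H)
  d₂ = dist₂ G (n H)

  baseTransmission : Fin (n G) → ℕ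
  baseTransmission a = sumFin (d₀ a) + (s * d₁ a u + t * d₁ a v)

  pendantTransmission : Fin (n G) → ℕ
  pendantTransmission w = sumFin (d₁ w) + (s * d₂ w u + t * d₂ w v)

  transmission-base : ∀ a → transmission H (base a) ≡ baseTransmission a
  transmission-base a = trans (sumFin-++ (n G) (s + t) _) (cong₂ _+_
    (sumFin-cong (dist-base-base a))
    (trans (sumFin-cong (dist-base-pendant a)) (sum-pendants (d₁ a))))

  -- a pendant vertex is at distance 0 from itself, not d₂ w w as from the other pendants at w
  transmission-pendant : ∀ p → transmission H (pendant p) + d₂ (anchor p) (anchor p) ≡ pendantTransmission (anchor p)
  transmission-pendant p = begin
    transmission H (pendant p) + d₂ w w
      ≡⟨ cong (_+ d₂ w w) (sumFin-++ (n G) (s + t) _) ⟩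
    sumFin (λ b → dist H (pendant p) (base b)) + sumFin (λ q → dist H (pendant p) (pendant q)) + d₂ w w
      ≡⟨ +-assoc (sumFin (λ b → dist H (pendant p) (base b))) _ _ ⟩
    sumFin (λ b → dist H (pendant p) (base b)) + (sumFin (λ q → dist H (pendant p) (pendant q)) + d₂ w w)
      ≡⟨ cong₂ _+_ (sumFin-cong (dist-pendant-base p))
           (sumFin-except _ (λ q → d₂ w (anchor q)) p (dist-refl H (pendant p)) dist-pendant-pendant) ⟩
    sumFin (d₁ w) + sumFin (λ q → d₂ w (anchor q))
      ≡⟨ cong (sumFin (d₁ w) +_) (sum-pendants (d₂ w)) ⟩
    sumFin (d₁ w) + (s * d₂ w u + t * d₂ w v) ∎
    where w = anchor p

  base-part : sumFin (λ a → degree H (base a) * transmission H (base a)) ≡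
    sumFin (λ a → degree G a * sumFin (d₀ a))
      + (s * sumFin (λ a → degree G a * d₁ a u) + t * sumFin (λ a → degree G a * d₁ a v))
      + (s * baseTransmission u + t * baseTransmission v)
  base-part = begin
    sumFin (λ a → degree H (base a) * transmission H (base a))
      ≡⟨ sumFin-cong (λ a → trans (cong₂ _*_ (degree-base a) (transmission-base a))
                                  (distribʳ (degree G a) (δ a u) (δ a v) (T a) s t)) ⟩
    sumFin (λ a → degree G a * T a + (s * (δ a u * T a) + t * (δ a v * T a)))
      ≡⟨ sumFin-linear {n G} _ _ _ s t ⟩
    sumFin (λ a → degree G a * T a) + (s * sumFin (λ a → δ a u * T a) + t * sumFin (λ a → δ a v * T a))
      ≡⟨ cong₂ (λ x y → sumFin (λ a → degree G a * T a) + (s * x + t * y)) (sumFin-δ T u) (sumFin-δ T v) ⟩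
    sumFin (λ a → degree G a * T a) + (s * T u + t * T v)
      ≡⟨ cong (_+ (s * T u + t * T v))
           (trans (sumFin-cong (λ a → distribˡ (degree G a) (sumFin (d₀ a)) (d₁ a u) (d₁ a v) s t))
                  (sumFin-linear {n G} _ _ _ s t)) ⟩
    sumFin (λ a → degree G a * sumFin (d₀ a))
      + (s * sumFin (λ a → degree G a * d₁ a u) + t * sumFin (λ a → degree G a * d₁ a v))
      + (s * T u + t * T v) ∎
    where
    T : Fin (n G) → ℕ
    T = baseTransmission
    distribʳ : ∀ x y z w s t → (x + (s * y + t * z)) * w ≡ x * w + (s * (y * w) + t * (z * w))
    distribʳ = solve-∀
    distribˡ : ∀ w x y z s t → w * (x + (s * y + t * z)) ≡ w * x + (s * (w * y) + t * (w * z))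
    distribˡ = solve-∀

  pendant-part : sumFin (λ q → degree H (pendant q) * transmission H (pendant q)) + (s * d₂ u u + t * d₂ v v) ≡
    s * pendantTransmission u + t * pendantTransmission v
  pendant-part = begin
    sumFin (λ q → degree H (pendant q) * transmission H (pendant q)) + (s * d₂ u u + t * d₂ v v)
      ≡⟨ cong₂ _+_ (sumFin-cong (λ q → trans (cong (_* transmission H (pendant q)) (degree-pendant q))
                                                 (*-identityˡ _)))
                   (sym (sum-pendants (λ w → d₂ w w))) ⟩
    sumFin (λ q → transmission H (pendant q)) + sumFin (λ q → d₂ (anchor q) (anchor q))
      ≡⟨ sym (sumFin-+ {s + t} _ _) ⟩
    sumFin (λ q → transmission H (pendant q) + d₂ (anchor q) (anchor q))
      ≡⟨ sumFin-cong transmission-pendant ⟩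
    sumFin (λ q → F (anchor q))
      ≡⟨ sum-pendants F ⟩
    s * F u + t * F v ∎
    where
    F : Fin (n G) → ℕ
    F = pendantTransmission

  degreeDistance-decomposition : degreeDistance H + (s * d₂ u u + t * d₂ v v) ≡
    sumFin (λ a → degree G a * sumFin (d₀ a))
      + (s * sumFin (λ a → degree G a * d₁ a u) + t * sumFin (λ a → degree G a * d₁ a v))
      + (s * baseTransmission u + t * baseTransmission v)
      + (s * pendantTransmission u + t * pendantTransmission v)
  degreeDistance-decomposition =
    trans (cong (_+ (s * d₂ u u + t * d₂ v v)) (sumFin-++ (n G) (s + t) _))
          (trans (+-assoc (sumFin (λ a → degree H (base a) * transmission H (base a))) _ _)
                 (cong₂ _+_ base-part pendant-part))

closedForm : (C X Y K s t : ℕ) → ℕ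
closedForm C X Y K s t = C + s * X + t * Y + (s * s * 3 + t * t * 3) + s * t * K

closedForm-swap : ∀ C X Y K s t → closedForm C X Y K s t ≡ closedForm C Y X K t s
closedForm-swap = ring
  where
  ring : ∀ C X Y K s t → C + s * X + t * Y + (s * s * 3 + t * t * 3) + s * t * K
                       ≡ C + t * Y + s * X + (t * t * 3 + s * s * 3) + t * s * K
  ring = solve-∀

closedForm-merge-< : ∀ C X Y K s t → X ≤ Y → 7 ≤ K → 1 ≤ s → 1 ≤ t →
  closedForm C X Y K (s + t) 0 < closedForm C X Y K s t
closedForm-merge-< C X Y K (suc s) (suc t) X≤Y 7≤K _ _ with m≤n⇒∃[o]m+o≡n X≤Y | m≤n⇒∃[o]m+o≡n 7≤K
... | y , refl | k , refl =
  subst (closedForm C X (X + y) (7 + k) (suc s + suc t) 0 <_) (gap C X y k s t) (m<m+n _ (s≤s z≤n))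
  where
  gap : ∀ C X y k s t →
    C + (suc s + suc t) * X + 0 * (X + y) + ((suc s + suc t) * (suc s + suc t) * 3 + 0 * 0 * 3)
      + (suc s + suc t) * 0 * (7 + k)
      + suc (suc t * y + (s + t + s * t) + suc s * suc t * k)
    ≡ C + suc s * X + suc t * (X + y) + (suc s * suc s * 3 + suc t * suc t * 3) + suc s * suc t * (7 + k)
  gap = solve-∀

closedForm-split-< : ∀ C X Y K s t → 7 ≤ K → 1 ≤ s → 1 ≤ t →
  closedForm C X Y K (s + t) 0 ⊓ closedForm C X Y K 0 (s + t) < closedForm C X Y K s t
closedForm-split-< C X Y K s t 7≤K 1≤s 1≤t with ≤-total X Y
... | inj₁ X≤Y = m<n⇒m⊓o<n _ (closedForm-merge-< C X Y K s t X≤Y 7≤K 1≤s 1≤t)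
... | inj₂ Y≤X = m<n⇒o⊓m<n _ (subst₂ _<_ merged (sym (closedForm-swap C X Y K s t))
                                (closedForm-merge-< C Y X K t s Y≤X 7≤K 1≤t 1≤s))
  where
  merged : closedForm C Y X K (t + s) 0 ≡ closedForm C X Y K 0 (s + t)
  merged = trans (cong (λ r → closedForm C Y X K r 0) (+-comm t s)) (sym (closedForm-swap C X Y K 0 (s + t)))

-- For connected G and large b, with d = d_G and D = D_G: degreeDistance₀ G b = D'(G),
-- pendantWeight G b w = Σₓ d(x)(d(x,w) + 1) + D(w) + Σₓ (d(w,x) + 1) and crossWeight G b u v = 4 d(u,v) + 6.
degreeDistance₀ : (G : Graph) → ℕ → ℕ
degreeDistance₀ G b = sumFin (λ a → degree G a * sumFin (dist₀ G b a))

pendantWeight : (G : Graph) → ℕ → Fin (n G) → ℕ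
pendantWeight G b w = sumFin (λ a → degree G a * dist₁ G b a w) + sumFin (dist₀ G b w) + sumFin (dist₁ G b w)

crossWeight : (G : Graph) → ℕ → Fin (n G) → Fin (n G) → ℕ
crossWeight G b u v = dist₁ G b u v + dist₁ G b v u + dist₂ G b u v + dist₂ G b v u

crossWeight-≢ : ∀ G {b} → 3 ≤ b → ∀ {u v} → u ≢ v → 10 ≤ crossWeight G b u v
crossWeight-≢ G {b} 3≤b u≢v = +-mono-≤ (+-mono-≤ (+-mono-≤
  (dist₁-≢ G 2≤b u≢v) (dist₁-≢ G 2≤b (≢-sym u≢v))) (dist₂-≢ G 3≤b u≢v)) (dist₂-≢ G 3≤b (≢-sym u≢v))
  where
  2≤b : 2 ≤ b
  2≤b = ≤-trans (s≤s (s≤s z≤n)) 3≤b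

degreeDistance-attach : ∀ G u v s t r → s + t ≡ r → 3 ≤ n G + r →
  degreeDistance (attach G u v s t) + r * 2 ≡
    closedForm (degreeDistance₀ G (n G + r)) (pendantWeight G (n G + r) u)
         (pendantWeight G (n G + r) v) (crossWeight G (n G + r) u v) s t
degreeDistance-attach G u v s t .(s + t) refl 3≤N = begin
  degreeDistance H + (s + t) * 2
    ≡⟨ cong (degreeDistance H +_) (trans (*-distribʳ-+ 2 s t)
         (cong₂ (λ x y → s * x + t * y) (sym (dist₂-self G 3≤N u)) (sym (dist₂-self G 3≤N v)))) ⟩
  degreeDistance H + (s * d₂ u u + t * d₂ v v)
    ≡⟨ degreeDistance-decomposition ⟩
  C + (s * Su + t * Sv)
    + (s * (Du + (s * d₁ u u + t * d₁ u v)) + t * (Dv + (s * d₁ v u + t * d₁ v v)))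
    + (s * (Pu + (s * d₂ u u + t * d₂ u v)) + t * (Pv + (s * d₂ v u + t * d₂ v v)))
    ≡⟨ regroup C Su Sv Du Dv Pu Pv (d₁ u u) (d₁ v v) (d₂ u u) (d₂ v v) (d₁ u v) (d₁ v u) (d₂ u v) (d₂ v u) s t ⟩
  C + s * X + t * Y + (s * s * (d₁ u u + d₂ u u) + t * t * (d₁ v v + d₂ v v)) + s * t * K
    ≡⟨ cong₂ (λ x y → C + s * X + t * Y + (s * s * x + t * t * y) + s * t * K)
         (cong₂ _+_ (dist₁-self G 2≤N u) (dist₂-self G 3≤N u))
         (cong₂ _+_ (dist₁-self G 2≤N v) (dist₂-self G 3≤N v)) ⟩
  closedForm C X Y K s t ∎
  where
  open Attached G u v s t
  N C X Y K Su Sv Du Dv Pu Pv : ℕ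
  N = n G + (s + t)
  2≤N : 2 ≤ N
  2≤N = ≤-trans (s≤s (s≤s z≤n)) 3≤N
  C = degreeDistance₀ G N
  X = pendantWeight G N u
  Y = pendantWeight G N v
  K = crossWeight G N u v
  Su = sumFin (λ a → degree G a * d₁ a u)
  Sv = sumFin (λ a → degree G a * d₁ a v)
  Du = sumFin (d₀ u)
  Dv = sumFin (d₀ v)
  Pu = sumFin (d₁ u)
  Pv = sumFin (d₁ v)
  regroup : ∀ C Su Sv Du Dv Pu Pv xu xv yu yv a b c d s t →
    C + (s * Su + t * Sv) + (s * (Du + (s * xu + t * a)) + t * (Dv + (s * b + t * xv)))
      + (s * (Pu + (s * yu + t * c)) + t * (Pv + (s * d + t * yv)))
    ≡ C + s * (Su + Du + Pu) + t * (Sv + Dv + Pv) + (s * s * (xu + yu) + t * t * (xv + yv))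
      + s * t * (a + b + c + d)
  regroup = solve-∀

lemma2 : (G₀ : Graph) → IsSimple G₀ → Connected G₀ → 3 ≤ n G₀ →
    (u v : Fin (n G₀)) → u ≢ v → (s t : ℕ) → 1 ≤ s → 1 ≤ t →
    degreeDistance (attach G₀ u v s t) >
    (degreeDistance (attach G₀ u v (s + t) 0) ⊓ degreeDistance (attach G₀ u v 0 (s + t)))
lemma2 G₀ _ _ 3≤n u v u≢v s t 1≤s 1≤t = +-cancelʳ-< ((s + t) * 2) _ _
  (subst₂ _<_ (sym merged) (sym (formula s t refl)) (closedForm-split-< C X Y K s t 7≤K 1≤s 1≤t))
  where
  DD : ℕ → ℕ → ℕ
  DD s′ t′ = degreeDistance (attach G₀ u v s′ t′)
  N C X Y K : ℕ
  N = n G₀ + (s + t)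
  3≤N : 3 ≤ N
  3≤N = ≤-trans 3≤n (m≤m+n (n G₀) (s + t))
  C = degreeDistance₀ G₀ N
  X = pendantWeight G₀ N u
  Y = pendantWeight G₀ N v
  K = crossWeight G₀ N u v
  formula : ∀ s′ t′ → s′ + t′ ≡ s + t → DD s′ t′ + (s + t) * 2 ≡ closedForm C X Y K s′ t′
  formula s′ t′ eq = degreeDistance-attach G₀ u v s′ t′ (s + t) eq 3≤N
  merged : (DD (s + t) 0 ⊓ DD 0 (s + t)) + (s + t) * 2 ≡ closedForm C X Y K (s + t) 0 ⊓ closedForm C X Y K 0 (s + t)
  merged = trans (+-distribʳ-⊓ ((s + t) * 2) (DD (s + t) 0) (DD 0 (s + t)))
                 (cong₂ _⊓_ (formula (s + t) 0 (+-identityʳ (s + t))) (formula 0 (s + t) refl))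
  7≤K : 7 ≤ K
  7≤K = ≤-trans (m≤m+n 7 3) (crossWeight-≢ G₀ 3≤N u≢v)
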